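{- Let $G$ be an infinite graph and $S$ a finite resolving set of $G$. Suppose $\mathcal{P}$ is a set of metric rays in $G$ with pairwise disjoint vertex sets. Then $S$ doubly resolves the set of vertices $\{u_{i(P,S)}^P : P\in\mathcal{P}\}$, where $u^P_{i(P,S)}$ denotes the vertex with index $i(P,S)$ in the ordering of $P$.
   Context: All graphs are simple, connected and locally finite. $d_G$ is the shortest-path distance. A vertex $x$ resolves $u,v$ if $d(u,x)\neq d(v,x)$; $S$ is a resolving set if every pair of distinct vertices is resolved by some vertex of $S$. For $S=\{x_1,\dots,x_n\}$, $r(u\mid S)=(d(u,x_1),\dots,d(u,x_n))$. A metric ray with endpoint $u_0$ in $G$ is a subgraph $P$ isomorphic to the one-way infinite path, with an ordering $V(P)=\{u_0,u_1,u_2,\dots\}$ such that $u_k$ is adjacent to $u_{k+1}$ in $P$ for all $k\ge 0$ and $d_G(u_0,u_k)=d_P(u_0,u_k)=k$. For a finite set $S$ and a metric ray $P$, $i(P,S)$ is the minimum integer $i_0\ge 0$ such that $r(u_{i_0+k}\mid S)=r(u_{i_0}\mid S)+(k,\dots,k)$ for all $k\ge 0$ (such an integer always exists). Two vertices $x,y$ doubly resolve $u,v$ if $d(u,x)-d(v,x)\neq d(u,y)-d(v,y)$; $S$ doubly resolves a set $U$ if every pair of distinct vertices of $U$ is doubly resolved by two vertices of $S$. -}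

module Defs where

open import Data.Nat using (ℕ; zero; suc; _+_; _≤_; _<_)
open import Data.Integer as ℤ using (ℤ; +_)
open import Data.List using (List)
open import Data.List.Membership.Propositional using (_∈_)
open import Data.Product using (Σ; ∃; ∃-syntax; _×_; _,_)
open import Data.Empty using (⊥)
open import Relation.Nullary using (¬_)
open import Relation.Binary.PropositionalEquality using (_≡_; _≢_)

record Graph : Set₁ where
  field
    V      : Set
    _~_    : V → V → Set
    ~-sym  : ∀ {u v} → u ~ v → v ~ u
    ~-irr  : ∀ {u} → ¬ (u ~ u)
open Graph public

data Walk (G : Graph) : V G → V G → ℕ → Set where
  here : ∀ {u} → Walk G u u zero
  step : ∀ {u v w n} → _~_ G u v → Walk G v w n → Walk G u w (suc n)

Connected : Graph → Set
Connected G = ∀ (u v : V G) → ∃[ n ] Walk G u v n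

LocallyFinite : Graph → Set
LocallyFinite G = ∀ (u : V G) → Σ (List (V G)) λ N → ∀ v → (_~_ G u v → v ∈ N) × (v ∈ N → _~_ G u v)

Infinite : Graph → Set
Infinite G = ¬ (Σ (List (V G)) λ L → ∀ v → v ∈ L)

IsShortestPathDist : (G : Graph) → (V G → V G → ℕ) → Set
IsShortestPathDist G d =
  ∀ (u v : V G) → Walk G u v (d u v) × (∀ n → Walk G u v n → d u v ≤ n)

module _ (G : Graph) (d : V G → V G → ℕ) where

  IsResolving : List (V G) → Set
  IsResolving S = ∀ (u v : V G) → u ≢ v → ∃[ x ] (x ∈ S × d u x ≢ d v x)

  -- A metric ray u₀,u₁,u₂,… (the ordering of its vertex set): consecutive
  -- vertices adjacent and d_G(u₀,u_k) = k (= d_P(u₀,u_k)).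
  record MetricRay : Set where
    field
      pt    : ℕ → V G
      adj   : ∀ k → _~_ G (pt k) (pt (suc k))
      metric : ∀ k → d (pt 0) (pt k) ≡ k
  open MetricRay public

  StableFrom : List (V G) → MetricRay → ℕ → Set
  StableFrom S P i = ∀ (k : ℕ) (x : V G) → x ∈ S → d (pt P (i + k)) x ≡ d (pt P i) x + k

  IsIndex : List (V G) → MetricRay → ℕ → Set
  IsIndex S P i = StableFrom S P i × (∀ j → j < i → ¬ StableFrom S P j)

  DoublyResolves : V G → V G → V G → V G → Set
  DoublyResolves x y u v =
    (+ d u x) ℤ.- (+ d v x) ≢ (+ d u y) ℤ.- (+ d v y)

  DoublyResolvesSet : List (V G) → {I : Set} → (I → V G) → Set
  DoublyResolvesSet S {I} w =
    ∀ (p q : I) → w p ≢ w q → ∃[ x ] ∃[ y ] (x ∈ S × y ∈ S × DoublyResolves x y (w p) (w q))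

module Submission where

-- Let u = u^P_{i(P,S)} and v = u^Q_{i(Q,S)} be distinct, so P ≠ Q.
-- If no two vertices of S doubly resolve u and v, then the difference
-- d(u,x) − d(v,x) is the same integer for every x ∈ S; say it is c ≥ 0
-- (otherwise exchange u and v).  Then r(u | S) = r(v | S) + (c,…,c).  Since
-- the ray Q is stable from v, i.e. r(u^Q_{i(Q,S)+k} | S) = r(v | S) + (k,…,k),
-- the vertex u^Q_{i(Q,S)+c} has the same representation as u, yet it differs
-- from u because the rays are disjoint; this contradicts that S resolves G.
--
-- The theorem combines these.  Only the
-- stability of the rays from their indices i(P,S) is used, not minimality.

open import Defs
open import Data.Nat using (ℕ; _+_; _∸_; _≤_)
open import Data.Nat.Properties using (+-comm; +-cancelʳ-≡; m∸n+n≡m; ≤-total)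
open import Data.Integer as ℤ using (ℤ; +_)
open import Data.Integer.Properties using (pos-+; +-injective)
import Data.Integer.Tactic.RingSolver as ℤ-Solver
import Data.Nat.Tactic.RingSolver as ℕ-Solver
open import Data.List using (List)
open import Data.List.Membership.Propositional using (_∈_; find)
open import Data.List.Relation.Unary.All as All using (All; all?)
open import Data.List.Relation.Unary.All.Properties.Core using (¬All⇒Any¬)
open import Data.Product using (∃-syntax; _×_; _,_; proj₁)
open import Data.Sum using (_⊎_; inj₁; inj₂; [_,_]′)
open import Data.Empty using (⊥-elim)
open import Relation.Nullary using (¬_; yes; no)
open import Relation.Binary.Definitions using (DecidableEquality)
open import Relation.Binary.PropositionalEquality
  using (_≡_; _≢_; refl; sym; trans; cong; module ≡-Reasoning)

differences-equal⇒cross-sums-equal : ∀ a b a' b' →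
  (+ a) ℤ.- (+ b) ≡ (+ a') ℤ.- (+ b') → a + b' ≡ a' + b
differences-equal⇒cross-sums-equal a b a' b' eq = +-injective (begin
  + (a + b')                               ≡⟨ pos-+ a b' ⟩
  + a ℤ.+ + b'                             ≡⟨ regroup (+ a) (+ b) (+ b') ⟩
  ((+ a) ℤ.- (+ b)) ℤ.+ (+ b ℤ.+ + b')     ≡⟨ cong (ℤ._+ (+ b ℤ.+ + b')) eq ⟩
  ((+ a') ℤ.- (+ b')) ℤ.+ (+ b ℤ.+ + b')   ≡⟨ unregroup (+ a') (+ b') (+ b) ⟩
  + a' ℤ.+ + b                             ≡⟨ pos-+ a' b ⟨
  + (a' + b)                               ∎)
  where
  open ≡-Reasoning
  regroup : ∀ x y z → x ℤ.+ z ≡ (x ℤ.- y) ℤ.+ (y ℤ.+ z)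
  regroup = ℤ-Solver.solve-∀
  unregroup : ∀ x y z → (x ℤ.- y) ℤ.+ (z ℤ.+ y) ≡ x ℤ.+ z
  unregroup = ℤ-Solver.solve-∀

cross-sums-equal⇒translate : ∀ {a b a' b'} → a + b' ≡ a' + b → b' ≤ a' →
  a ≡ b + (a' ∸ b')
cross-sums-equal⇒translate {a} {b} {a'} {b'} eq b'≤a' =
  +-cancelʳ-≡ b' a (b + (a' ∸ b')) (begin
    a + b'              ≡⟨ eq ⟩
    a' + b              ≡⟨ cong (_+ b) (m∸n+n≡m b'≤a') ⟨
    (a' ∸ b') + b' + b  ≡⟨ rotate (a' ∸ b') b' b ⟩
    b + (a' ∸ b') + b'  ∎)
  where
  open ≡-Reasoning
  rotate : ∀ x y z → x + y + z ≡ z + x + y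
  rotate = ℕ-Solver.solve-∀

constant-or-witness : {A B : Set} → DecidableEquality B → (f : A → B) (xs : List A) (s : A) →
  All (λ x → f x ≡ f s) xs ⊎ ∃[ x ] (x ∈ xs × f x ≢ f s)
constant-or-witness _≟_ f xs s with all? (λ x → f x ≟ f s) xs
... | yes constant = inj₁ constant
... | no ¬constant = inj₂ (find (¬All⇒Any¬ (λ x → f x ≟ f s) xs ¬constant))

module _ (G : Graph) (d : V G → V G → ℕ) (S : List (V G)) (resolving : IsResolving G d S) where

  -- A vertex off a metric ray Q cannot have the representation of a point
  -- Q_j of stability translated by c: that representation is already taken
  -- by Q_{j+c}, and S separates distinct vertices.
  off-ray-not-translate : (Q : MetricRay G d) (j c : ℕ) → StableFrom G d S Q j →
    (u : V G) → (∀ m → u ≢ MetricRay.pt Q m) →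
    ¬ (∀ x → x ∈ S → d u x ≡ d (MetricRay.pt Q j) x + c)
  off-ray-not-translate Q j c stable u off-ray translate
    with resolving u (MetricRay.pt Q (j + c)) (off-ray (j + c))
  ... | x , x∈S , separates = separates (trans (translate x x∈S) (sym (stable c x x∈S)))

  constant-nonnegative-gap-impossible : (Q : MetricRay G d) (j : ℕ) →
    StableFrom G d S Q j → (u : V G) → (∀ m → u ≢ MetricRay.pt Q m) → (s : V G) →
    let v = MetricRay.pt Q j in
    d v s ≤ d u s → ¬ (∀ x → x ∈ S → d u x + d v s ≡ d u s + d v x)
  constant-nonnegative-gap-impossible Q j stable u off-ray s gap≥0 cross =
    off-ray-not-translate Q j (d u s ∸ d v s) stable u off-ray
      (λ x x∈S → cross-sums-equal⇒translate (cross x x∈S) gap≥0)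
    where
    v : V G
    v = MetricRay.pt Q j

  -- Points u = P_i and v = Q_j of stability of two disjoint rays cannot have a
  -- difference d(u,x) − d(v,x) that is the same for all x ∈ S: according to
  -- its sign, u is a translate of v along Q or v a translate of u along P.
  constant-difference-impossible : (P Q : MetricRay G d) (i j : ℕ) →
    StableFrom G d S P i → StableFrom G d S Q j →
    (∀ m n → MetricRay.pt P m ≢ MetricRay.pt Q n) → (s : V G) →
    let u = MetricRay.pt P i ; v = MetricRay.pt Q j in
    ¬ All (λ x → (+ d u x) ℤ.- (+ d v x) ≡ (+ d u s) ℤ.- (+ d v s)) S
  constant-difference-impossible P Q i j P-stable Q-stable disjoint s constant =
    [ u-translate-of-v , v-translate-of-u ]′ (≤-total (d v s) (d u s))
    where
    u v : V G
    u = MetricRay.pt P i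
    v = MetricRay.pt Q j
    cross : ∀ x → x ∈ S → d u x + d v s ≡ d u s + d v x
    cross x x∈S = differences-equal⇒cross-sums-equal (d u x) (d v x) (d u s) (d v s)
                    (All.lookup constant x∈S)
    cross-swapped : ∀ x → x ∈ S → d v x + d u s ≡ d v s + d u x
    cross-swapped x x∈S =
      trans (+-comm (d v x) (d u s)) (trans (sym (cross x x∈S)) (+-comm (d u x) (d v s)))
    u-translate-of-v : ¬ d v s ≤ d u s
    u-translate-of-v v≤u = constant-nonnegative-gap-impossible Q j Q-stable u
      (λ m → disjoint i m) s v≤u cross
    v-translate-of-u : ¬ d u s ≤ d v s
    v-translate-of-u u≤v = constant-nonnegative-gap-impossible P i P-stable v
      (λ m v≡P_m → disjoint m j (sym v≡P_m)) s u≤v cross-swapped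

-- The theorem: if u ≠ v, pick s ∈ S (S is nonempty as it resolves u, v).
-- Either some x ∈ S has d(u,x) − d(v,x) ≠ d(u,s) − d(v,s), and then x, s
-- doubly resolve u, v, or the difference is constant on S, which is impossible.
lemma6 : (G : Graph) → Connected G → LocallyFinite G → Infinite G
    → (d : V G → V G → ℕ) → IsShortestPathDist G d
    → (S : List (V G)) → IsResolving G d S
    → (I : Set) (ray : I → MetricRay G d)
    → (∀ p q → p ≢ q → ∀ m n → MetricRay.pt (ray p) m ≢ MetricRay.pt (ray q) n)
    → (idx : I → ℕ) → (∀ p → IsIndex G d S (ray p) (idx p))
    → DoublyResolvesSet G d S (λ p → MetricRay.pt (ray p) (idx p))
lemma6 G _ _ _ d _ S resolving I ray disjoint idx isIndex p q u≢v =
  let (s , s∈S , _) = resolving u v u≢v in doubly-resolve-with s s∈S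
  where
  u v : V G
  u = MetricRay.pt (ray p) (idx p)
  v = MetricRay.pt (ray q) (idx q)
  difference : V G → ℤ
  difference x = (+ d u x) ℤ.- (+ d v x)
  p≢q : p ≢ q
  p≢q refl = u≢v refl
  stable : ∀ r → StableFrom G d S (ray r) (idx r)
  stable r = proj₁ (isIndex r)
  doubly-resolve-with : (s : V G) → s ∈ S →
    ∃[ x ] ∃[ y ] (x ∈ S × y ∈ S × DoublyResolves G d x y u v)
  doubly-resolve-with s s∈S with constant-or-witness ℤ._≟_ difference S s
  ... | inj₂ (x , x∈S , differs) = x , s , x∈S , s∈S , differs
  ... | inj₁ constant = ⊥-elim (constant-difference-impossible G d S resolving
          (ray p) (ray q) (idx p) (idx q) (stable p) (stable q)
          (disjoint p q p≢q) s constant)
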